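{- Fix an integer $k\ge0$. For all positive integers $i\le j$ and any fixed choice of signs (the same on both sides), $$N(\pm S^{(k)}_i,\pm S^{(k)}_j)=N(\pm S^{(k)}_1,\pm S^{(k)}_{j-i+1});$$ moreover, for all positive integers $j$ and $i$, $$N(-S^{(k)}_1,+S^{(k)}_j)+N(+S^{(k)}_1,+S^{(k)}_j)=N(+S^{(k)}_j)-N(+S^{(k)}_{j-1}),\qquad N(+S^{(k)}_i)=R_k(i)-R_k(i-1).$$
   Context: The $k$-Skipponacci numbers: $S^{(k)}_n=0$ for $n\le0$, $S^{(k)}_i=i$ for $1\le i\le k+1$, $S^{(k)}_{n+1}=S^{(k)}_n+S^{(k)}_{n-k}$ for $n\ge k+1$. Every integer has a unique far-difference representation $x=\sum_t\epsilon_tS^{(k)}_{n_t}$ ($\epsilon_t\in\{\pm1\}$, distinct indices $n_t\ge1$) with same-sign terms at least $2k+2$ apart in index and opposite-sign terms at least $k+2$ apart. $R_k(n)=S^{(k)}_n+S^{(k)}_{n-2k-2}+\cdots$ (positive indices only) for $n>0$, $R_k(n)=0$ for $n\le0$. $N(\epsilon S^{(k)}_i,\delta S^{(k)}_j)$ (with $\epsilon,\delta\in\{+,-\}$) denotes the number of integers whose far-difference representation begins with $\epsilon S^{(k)}_i$ (its summand of smallest index) and ends with $\delta S^{(k)}_j$ (its summand of largest index); $N(\pm S^{(k)}_j)$ denotes the number of integers whose representation ends with $\pm S^{(k)}_j$, with $N(+S^{(k)}_0)=0$. -}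

module Defs where

open import Data.Nat using (ℕ; zero; suc; _+_; _*_; _∸_; _≤ᵇ_; _≡ᵇ_)
open import Data.Bool using (Bool; true; false; if_then_else_; _∧_)
open import Data.List using (List; []; _∷_; _++_; [_]; concatMap)
open import Data.Product using (_×_; _,_; proj₁; proj₂)
open import Data.Integer using (ℤ)

-- k-Skipponacci numbers S^(k)_n  (S^(k)_n = 0 for n ≤ 0, here n = 0).
-- S^(k)_i = i for 1 ≤ i ≤ k+1, and S^(k)_{m} = S^(k)_{m-1} + S^(k)_{m-1-k}
-- for m ≥ k+2.  Defined with fuel (fuel ≥ index suffices).

S-aux : ℕ → ℕ → ℕ → ℕ
S-aux k zero    _       = 0
S-aux k (suc f) zero    = 0
S-aux k (suc f) (suc n) =
  if suc n ≤ᵇ suc k then suc n else S-aux k f n + S-aux k f (n ∸ k)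

S : ℕ → ℕ → ℕ
S k n = S-aux k n n

R-aux : ℕ → ℕ → ℕ → ℕ
R-aux k zero    _       = 0
R-aux k (suc f) zero    = 0
R-aux k (suc f) (suc n) = S k (suc n) + R-aux k f (suc n ∸ (2 * k + 2))

R : ℕ → ℕ → ℕ
R k n = R-aux k n n

data Sgn : Set where
  pos neg : Sgn

_==ˢ_ : Sgn → Sgn → Bool
pos ==ˢ pos = true
neg ==ˢ neg = true
_   ==ˢ _   = false

-- A term ε S^(k)_n is recorded as the pair (ε , n).
Term : Set
Term = Sgn × ℕ

value : ℕ → List Term → ℤ
value k [] = Data.Integer.+ 0
value k ((pos , n) ∷ ts) = Data.Integer._+_ (Data.Integer.+ S k n) (value k ts)
value k ((neg , n) ∷ ts) = Data.Integer._-_ (value k ts) (Data.Integer.+ S k n)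

-- All signed sums with distinct indices in {1,…,n}, listed with
-- strictly increasing indices (each index absent, +, or −).
candidates : ℕ → List (List Term)
candidates zero    = [] ∷ []
candidates (suc n) =
  candidates n ++
  concatMap (λ l → (l ++ [ (pos , suc n) ]) ∷ (l ++ [ (neg , suc n) ]) ∷ [])
            (candidates n)

allᵇ : {A : Set} → (A → Bool) → List A → Bool
allᵇ p []       = true
allᵇ p (x ∷ xs) = p x ∧ allᵇ p xs

farPair : ℕ → Term → Term → Bool
farPair k (ε , m) (δ , n) =
  if ε ==ˢ δ then (m + (2 * k + 2)) ≤ᵇ n else (m + (k + 2)) ≤ᵇ n

farDiff : ℕ → List Term → Bool
farDiff k []       = true
farDiff k (t ∷ ts) = (1 ≤ᵇ proj₂ t) ∧ allᵇ (farPair k t) ts ∧ farDiff k ts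

termEq : Term → Term → Bool
termEq (ε , m) (δ , n) = (ε ==ˢ δ) ∧ (m ≡ᵇ n)

firstIs : Term → List Term → Bool
firstIs t []      = false
firstIs t (u ∷ _) = termEq t u

lastIs : Term → List Term → Bool
lastIs t []           = false
lastIs t (u ∷ [])     = termEq t u
lastIs t (_ ∷ v ∷ us) = lastIs t (v ∷ us)

count : {A : Set} → (A → Bool) → List A → ℕ
count p []       = 0
count p (x ∷ xs) = if p x then suc (count p xs) else count p xs

-- N(ε S_i, δ S_j): number of far-difference representations (equivalently,
-- by uniqueness, of integers) with smallest summand ε S_i and largest δ S_j.
N₂ : ℕ → Sgn → ℕ → Sgn → ℕ → ℕ
N₂ k ε i δ j =
  count (λ l → farDiff k l ∧ firstIs (ε , i) l ∧ lastIs (δ , j) l) (candidates j)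

N₁ : ℕ → Sgn → ℕ → ℕ
N₁ k δ j = count (λ l → farDiff k l ∧ lastIs (δ , j) l) (candidates j)

{-# OPTIONS --safe #-}
module Submission where

-- Representations are listed with increasing indices and built by appending terms on the
-- right, and the far-difference condition only has to be checked between the last two terms
-- (the other gaps follow by transitivity).  Hence the representations ending with δ S_j,
-- each weighted by a function w of its first term, obey a recursion in j.  Its solution is
-- linear in w, and shifting all indices by s does not change it when w vanishes on indices
-- ≤ s: with w the indicator of the first term this gives the first identity, and splitting
-- the first term into −S_1, +S_1 or an index ≥ 2 gives the second.  For the constant weight
-- the recursion is symmetric in the sign of the last term and says that a(n) = N(+S_n)
-- satisfies a(n) = 1 + A(n−2k−2) + A(n−k−2) for the partial sums A of a.  Since
-- S_{m+1} = 1 + R_k(m) + R_k(m−k−1), R_k obeys the same recurrence as A, so A = R_k and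
-- N(+S_i) = R_k(i) − R_k(i−1).

open import Defs
open import Data.Nat using (ℕ; zero; suc; _+_; _*_; _∸_; _⊓_; _≤_; _<_; _≤ᵇ_; _≡ᵇ_; z≤n; s≤s)
open import Data.Nat.Properties
open import Data.Nat.Induction using (<-rec)
open import Data.Nat.Tactic.RingSolver using (solve-∀)
open import Data.Integer using (+_; _-_; _⊖_)
import Data.Integer.Properties as ℤₚ
open import Data.Bool using (Bool; true; false; T; if_then_else_; _∧_)
open import Data.Bool.Properties
  using (∧-assoc; ∧-zeroʳ; ∧-identityʳ; T-∧; if-cong-else; ∧-commutativeMonoid)
open import Algebra.Bundles using (CommutativeMonoid)
open import Algebra.Properties.CommutativeSemigroup +-commutativeSemigroup using (interchange)
open import Algebra.Properties.CommutativeSemigroup (CommutativeMonoid.commutativeSemigroup ∧-commutativeMonoid)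
  using (xy∙z≈xz∙y)
open import Algebra.Solver.CommutativeMonoid ∧-commutativeMonoid using (solve; _⊜_; _⊕_)
open import Data.List using (List; []; _∷_; _++_; _∷ʳ_; concatMap)
open import Data.Product using (_×_; _,_; proj₁; proj₂)
open import Data.Unit using (tt)
open import Function using (_∘_; mk⇔; Equivalence)
open import Relation.Binary.PropositionalEquality
  using (_≡_; _≢_; _≗_; refl; sym; trans; cong; cong₂; subst; module ≡-Reasoning)
open import Relation.Nullary using (¬_; yes; no; contradiction)
open import Relation.Nullary.Decidable using (does-⇔; dec-true; dec-false)
open import Relation.Nullary.Reflects using (ofʸ; ofⁿ)

open ≡-Reasoning

when : Bool → ℕ → ℕ
when b n = if b then n else 0

when-+ : ∀ b m n → when b (m + n) ≡ when b m + when b n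
when-+ true  m n = refl
when-+ false m n = refl

when-0 : ∀ b → when b 0 ≡ 0
when-0 true  = refl
when-0 false = refl

if-T : ∀ {A : Set} {b} {x y : A} → T b → (if b then x else y) ≡ x
if-T {b = true} _ = refl

if-¬T : ∀ {A : Set} {b} {x y : A} → ¬ T b → (if b then x else y) ≡ y
if-¬T {b = true}  ¬b = contradiction tt ¬b
if-¬T {b = false} _  = refl

-- does (m ≤? n) and does (m ≟ n) compute to m ≤ᵇ n and m ≡ᵇ n.
≤ᵇ-+ʳ : ∀ s m n → (m + s ≤ᵇ n + s) ≡ (m ≤ᵇ n)
≤ᵇ-+ʳ s m n = does-⇔ (mk⇔ (+-cancelʳ-≤ s m n) (+-monoˡ-≤ s)) (m + s ≤? n + s) (m ≤? n)

≡ᵇ-+ʳ : ∀ s m n → (m + s ≡ᵇ n + s) ≡ (m ≡ᵇ n)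
≡ᵇ-+ʳ s m n = does-⇔ (mk⇔ (+-cancelʳ-≡ s m n) (cong (_+ s))) (m + s ≟ n + s) (m ≟ n)

suc-∸-≤ : ∀ n g → 1 ≤ g → suc n ∸ g ≤ n
suc-∸-≤ n (suc g) _ = m∸n≤m n g

∸≡suc[∸suc] : ∀ {m n} → n < m → m ∸ n ≡ suc (m ∸ suc n)
∸≡suc[∸suc] {suc m} {zero}  _         = refl
∸≡suc[∸suc] {suc m} {suc n} (s≤s n<m) = ∸≡suc[∸suc] n<m

m+n≡o⇒+m≡+o-+n : ∀ {m n o} → m + n ≡ o → + m ≡ + o - + n
m+n≡o⇒+m≡+o-+n {m} {n} refl = sym (begin
  + (m + n) - + n   ≡⟨ ℤₚ.[+m]-[+n]≡m⊖n (m + n) n ⟩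
  (m + n) ⊖ n      ≡⟨ ℤₚ.⊖-≥ (m≤n+m n m) ⟩
  + (m + n ∸ n)     ≡⟨ cong +_ (m+n∸n≡m m n) ⟩
  + m               ∎)

partialSum : (ℕ → ℕ) → ℕ → ℕ
partialSum f zero    = 0
partialSum f (suc n) = partialSum f n + f (suc n)

partialSum-⊓ : ∀ f g m n →
  partialSum f (suc n ⊓ (m ∸ g)) ≡ partialSum f (n ⊓ (m ∸ g)) + when (suc n + g ≤ᵇ m) (f (suc n))
partialSum-⊓ f g m n with suc n + g ≤ᵇ m | ≤ᵇ-reflects-≤ (suc n + g) m
... | true  | ofʸ sn+g≤m = begin
  partialSum f (suc n ⊓ (m ∸ g))
    ≡⟨ cong (partialSum f) (m≤n⇒m⊓n≡m sn≤m∸g) ⟩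
  partialSum f n + f (suc n)
    ≡⟨ cong (λ i → partialSum f i + f (suc n)) (m≤n⇒m⊓n≡m (<⇒≤ sn≤m∸g)) ⟨
  partialSum f (n ⊓ (m ∸ g)) + f (suc n)  ∎
  where
  sn≤m∸g : suc n ≤ m ∸ g
  sn≤m∸g = m+n≤o⇒m≤o∸n (suc n) sn+g≤m
... | false | ofⁿ sn+g≰m = begin
  partialSum f (suc n ⊓ (m ∸ g))  ≡⟨ cong (partialSum f) (m≥n⇒m⊓n≡n (≤-trans m∸g≤n (n≤1+n n))) ⟩
  partialSum f (m ∸ g)            ≡⟨ cong (partialSum f) (m≥n⇒m⊓n≡n m∸g≤n) ⟨
  partialSum f (n ⊓ (m ∸ g))      ≡⟨ +-identityʳ _ ⟨
  partialSum f (n ⊓ (m ∸ g)) + 0  ∎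
  where
  m∸g≤n : m ∸ g ≤ n
  m∸g≤n = m≤n+o⇒m∸n≤o m g (subst (m ≤_) (+-comm n g) (≤-pred (≰⇒> sn+g≰m)))

recurrence-unique : ∀ {g h} → 1 ≤ g → 1 ≤ h → ∀ {F G : ℕ → ℕ} → F 0 ≡ G 0 →
  (∀ n → F (suc n) ≡ F n + suc (F (suc n ∸ g) + F (suc n ∸ h))) →
  (∀ n → G (suc n) ≡ G n + suc (G (suc n ∸ g) + G (suc n ∸ h))) →
  ∀ n → F n ≡ G n
recurrence-unique {g} {h} 1≤g 1≤h {F} {G} F0≡G0 F-rec G-rec = <-rec (λ n → F n ≡ G n) step
  where
  step : ∀ n → (∀ {m} → m < n → F m ≡ G m) → F n ≡ G n
  step zero    _  = F0≡G0
  step (suc n) ih = begin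
    F (suc n)
      ≡⟨ F-rec n ⟩
    F n + suc (F (suc n ∸ g) + F (suc n ∸ h))
      ≡⟨ cong₂ (λ a b → a + suc b) (ih ≤-refl)
               (cong₂ _+_ (ih (s≤s (suc-∸-≤ n g 1≤g))) (ih (s≤s (suc-∸-≤ n h 1≤h)))) ⟩
    G n + suc (G (suc n ∸ g) + G (suc n ∸ h))
      ≡⟨ G-rec n ⟨
    G (suc n) ∎

module _ {A : Set} where

  count-∷ : ∀ (p : A → Bool) x xs → count p (x ∷ xs) ≡ when (p x) 1 + count p xs
  count-∷ p x xs with p x
  ... | true  = refl
  ... | false = refl

  count-++ : ∀ (p : A → Bool) xs ys → count p (xs ++ ys) ≡ count p xs + count p ys
  count-++ p []       ys = refl
  count-++ p (x ∷ xs) ys with p x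
  ... | true  = cong suc (count-++ p xs ys)
  ... | false = count-++ p xs ys

  count-cong : ∀ {p q : A → Bool} → p ≗ q → count p ≗ count q
  count-cong p≗q []       = refl
  count-cong {p} {q} p≗q (x ∷ xs) with p x | q x | p≗q x
  ... | true  | true  | refl = cong suc (count-cong p≗q xs)
  ... | false | false | refl = count-cong p≗q xs

  count-none : ∀ {p : A → Bool} → (∀ x → p x ≡ false) → ∀ xs → count p xs ≡ 0
  count-none p≡false []       = refl
  count-none {p} p≡false (x ∷ xs) rewrite p≡false x = count-none p≡false xs

  count-∧ʳ : ∀ (p : A → Bool) b xs → count (λ x → p x ∧ b) xs ≡ when b (count p xs)
  count-∧ʳ p true  xs = count-cong (∧-identityʳ ∘ p) xs
  count-∧ʳ p false xs = count-none (∧-zeroʳ ∘ p) xs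

count-concatMap-pair : ∀ {A B : Set} (p : B → Bool) (f g : A → B) xs →
  count p (concatMap (λ x → f x ∷ g x ∷ []) xs) ≡ count (p ∘ f) xs + count (p ∘ g) xs
count-concatMap-pair p f g []       = refl
count-concatMap-pair p f g (x ∷ xs) = begin
  count p (f x ∷ g x ∷ rest)
    ≡⟨ count-∷ p (f x) (g x ∷ rest) ⟩
  a + count p (g x ∷ rest)
    ≡⟨ cong (_+_ a) (count-∷ p (g x) rest) ⟩
  a + (b + count p rest)
    ≡⟨ cong (λ c → a + (b + c)) (count-concatMap-pair p f g xs) ⟩
  a + (b + (count (p ∘ f) xs + count (p ∘ g) xs))
    ≡⟨ +-assoc a b _ ⟨
  (a + b) + (count (p ∘ f) xs + count (p ∘ g) xs)
    ≡⟨ interchange a b _ _ ⟩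
  (a + count (p ∘ f) xs) + (b + count (p ∘ g) xs)
    ≡⟨ cong₂ _+_ (count-∷ (p ∘ f) x xs) (count-∷ (p ∘ g) x xs) ⟨
  count (p ∘ f) (x ∷ xs) + count (p ∘ g) (x ∷ xs) ∎
  where
  rest = concatMap (λ x → f x ∷ g x ∷ []) xs
  a = when (p (f x)) 1
  b = when (p (g x)) 1

count-candidates-suc : ∀ (p : List Term → Bool) n →
  count p (candidates (suc n)) ≡
    count p (candidates n) + (count (λ l → p (l ∷ʳ (pos , suc n))) (candidates n)
                             + count (λ l → p (l ∷ʳ (neg , suc n))) (candidates n))
count-candidates-suc p n = trans (count-++ p (candidates n) _)
  (cong (_+_ (count p (candidates n)))
        (count-concatMap-pair p (_∷ʳ (pos , suc n)) (_∷ʳ (neg , suc n)) (candidates n)))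

firstSatisfies : (Term → Bool) → List Term → Bool
firstSatisfies g []      = false
firstSatisfies g (t ∷ _) = g t

firstSatisfies-∷ʳ-∷ʳ : ∀ g l u t → firstSatisfies g (l ∷ʳ u ∷ʳ t) ≡ firstSatisfies g (l ∷ʳ u)
firstSatisfies-∷ʳ-∷ʳ g []      u t = refl
firstSatisfies-∷ʳ-∷ʳ g (_ ∷ _) u t = refl

lastIs-∷ʳ : ∀ t l u → lastIs t (l ∷ʳ u) ≡ termEq t u
lastIs-∷ʳ t []          u = refl
lastIs-∷ʳ t (_ ∷ [])    u = refl
lastIs-∷ʳ t (_ ∷ v ∷ l) u = lastIs-∷ʳ t (v ∷ l) u

termEq-same-index : ∀ ε δ m → termEq (ε , m) (δ , m) ≡ (ε ==ˢ δ)
termEq-same-index ε δ m = trans (cong ((ε ==ˢ δ) ∧_) (dec-true (m ≟ m) refl)) (∧-identityʳ (ε ==ˢ δ))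

termEq-≢ : ∀ ε δ {m n} → m ≢ n → termEq (ε , m) (δ , n) ≡ false
termEq-≢ ε δ {m} {n} m≢n = trans (cong ((ε ==ˢ δ) ∧_) (dec-false (m ≟ n) m≢n)) (∧-zeroʳ (ε ==ˢ δ))

module _ {A : Set} where

  allᵇ-∷ʳ : ∀ (p : A → Bool) l x → allᵇ p (l ∷ʳ x) ≡ allᵇ p l ∧ p x
  allᵇ-∷ʳ p []      x = ∧-identityʳ (p x)
  allᵇ-∷ʳ p (a ∷ l) x = trans (cong (p a ∧_) (allᵇ-∷ʳ p l x)) (sym (∧-assoc (p a) (allᵇ p l) (p x)))

  allᵇ-mono : ∀ {p q : A → Bool} → (∀ x → T (p x) → T (q x)) → ∀ l → T (allᵇ p l) → T (allᵇ q l)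
  allᵇ-mono p⇒q []      _  = tt
  allᵇ-mono p⇒q (x ∷ l) pl with Equivalence.to T-∧ pl
  ... | px , pl′ = Equivalence.from T-∧ (p⇒q x px , allᵇ-mono p⇒q l pl′)

∧-drop-implied : ∀ a b c d → (T a → T b → T (c ∧ d)) → (a ∧ (c ∧ b)) ∧ d ≡ a ∧ b
∧-drop-implied false _     _     _     _      = refl
∧-drop-implied true  false c     d     _      = cong (_∧ d) (∧-zeroʳ c)
∧-drop-implied true  true  true  true  _      = refl
∧-drop-implied true  true  false _     b⇒c∧d = contradiction (b⇒c∧d tt tt) λ ()
∧-drop-implied true  true  true  false b⇒c∧d = contradiction (b⇒c∧d tt tt) λ ()

-- Index 0 gets weight 0 since S_0 is not a summand.
weight : (Term → Bool) → Term → ℕ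
weight g (ε , zero)  = 0
weight g (ε , suc n) = when (g (ε , suc n)) 1

_+ʷ_ : (Term → ℕ) → (Term → ℕ) → Term → ℕ
(w₁ +ʷ w₂) t = w₁ t + w₂ t

shift : ℕ → (Term → ℕ) → Term → ℕ
shift s w (δ , m) = w (δ , m + s)

SignSymmetric : (Term → ℕ) → Set
SignSymmetric w = ∀ m → w (pos , m) ≡ w (neg , m)

weight-termEq-vanishes : ∀ ε s δ m → m ≤ s → weight (termEq (ε , suc s)) (δ , m) ≡ 0
weight-termEq-vanishes ε s δ zero    _   = refl
weight-termEq-vanishes ε s δ (suc m) m<s =
  cong (λ b → when b 1) (termEq-≢ ε δ λ s+1≡m+1 → <-irrefl (sym (suc-injective s+1≡m+1)) m<s)

shift-weight-termEq : ∀ ε s → shift s (weight (termEq (ε , suc s))) ≗ weight (termEq (ε , 1))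
shift-weight-termEq ε s (δ , zero)  = weight-termEq-vanishes ε s δ s ≤-refl
shift-weight-termEq ε s (δ , suc m) = cong (λ b → when ((ε ==ˢ δ) ∧ b) 1) (≡ᵇ-+ʳ s 0 m)

atLeastTwo : Term → Bool
atLeastTwo t = 2 ≤ᵇ proj₂ t

weight-split : weight (λ _ → true) ≗ (weight (termEq (neg , 1)) +ʷ weight (termEq (pos , 1))) +ʷ weight atLeastTwo
weight-split (δ   , zero)        = refl
weight-split (pos , suc zero)    = refl
weight-split (neg , suc zero)    = refl
weight-split (pos , suc (suc m)) = refl
weight-split (neg , suc (suc m)) = refl

weight-atLeastTwo-vanishes : ∀ δ m → m ≤ 1 → weight atLeastTwo (δ , m) ≡ 0
weight-atLeastTwo-vanishes δ zero          _        = refl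
weight-atLeastTwo-vanishes δ (suc zero)    _        = refl
weight-atLeastTwo-vanishes δ (suc (suc m)) (s≤s ())

shift-weight-atLeastTwo : shift 1 (weight atLeastTwo) ≗ weight (λ _ → true)
shift-weight-atLeastTwo (δ , zero)  = refl
shift-weight-atLeastTwo (δ , suc m) rewrite +-comm m 1 = refl

weight-true-symmetric : SignSymmetric (weight (λ _ → true))
weight-true-symmetric zero    = refl
weight-true-symmetric (suc m) = refl

module _ (k : ℕ) where

  gap : Sgn → Sgn → ℕ
  gap ε δ = if ε ==ˢ δ then 2 * k + 2 else k + 2

  farPair-gap : ∀ ε δ m n → farPair k (ε , m) (δ , n) ≡ (m + gap ε δ ≤ᵇ n)
  farPair-gap pos pos m n = refl
  farPair-gap pos neg m n = refl
  farPair-gap neg pos m n = refl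
  farPair-gap neg neg m n = refl

  1≤k+2 : 1 ≤ k + 2
  1≤k+2 = ≤-trans (s≤s z≤n) (m≤n+m 2 k)

  1≤2k+2 : 1 ≤ 2 * k + 2
  1≤2k+2 = ≤-trans (s≤s z≤n) (m≤n+m 2 (2 * k))

  k+2≤2k+2 : k + 2 ≤ 2 * k + 2
  k+2≤2k+2 = +-monoˡ-≤ 2 (m≤m+n k (k + 0))

  k+2≤gap : ∀ ε δ → k + 2 ≤ gap ε δ
  k+2≤gap pos pos = k+2≤2k+2
  k+2≤gap pos neg = ≤-refl
  k+2≤gap neg pos = ≤-refl
  k+2≤gap neg neg = k+2≤2k+2

  gap≤2[k+2] : ∀ ε δ → gap ε δ ≤ (k + 2) + (k + 2)
  gap≤2[k+2] ε δ = ≤-trans (gap≤2k+2 ε δ) (subst (2 * k + 2 ≤_) (2k+4 k) (m≤m+n _ 2))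
    where
    2k+4 : ∀ k → 2 * k + 2 + 2 ≡ (k + 2) + (k + 2)
    2k+4 = solve-∀
    gap≤2k+2 : ∀ ε δ → gap ε δ ≤ 2 * k + 2
    gap≤2k+2 pos pos = ≤-refl
    gap≤2k+2 pos neg = k+2≤2k+2
    gap≤2k+2 neg pos = k+2≤2k+2
    gap≤2k+2 neg neg = ≤-refl

  farPair⇒≤ : ∀ t u → T (farPair k t u) → proj₂ t + (k + 2) ≤ proj₂ u
  farPair⇒≤ (ε , m) (δ , n) far =
    ≤-trans (+-monoʳ-≤ m (k+2≤gap ε δ)) (≤ᵇ⇒≤ _ _ (subst T (farPair-gap ε δ m n) far))

  ≤⇒farPair : ∀ t u → proj₂ t + (k + 2) + (k + 2) ≤ proj₂ u → T (farPair k t u)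
  ≤⇒farPair (ε , m) (δ , n) le = subst T (sym (farPair-gap ε δ m n))
    (≤⇒≤ᵇ (≤-trans (+-monoʳ-≤ m (gap≤2[k+2] ε δ)) (subst (_≤ n) (+-assoc m _ _) le)))

  farPair-trans : ∀ t u v → T (farPair k t u) → T (farPair k u v) → T (farPair k t v)
  farPair-trans t u v tu uv =
    ≤⇒farPair t v (≤-trans (+-monoˡ-≤ (k + 2) (farPair⇒≤ t u tu)) (farPair⇒≤ u v uv))

  farPair⇒1≤ : ∀ t u → T (farPair k t u) → T (1 ≤ᵇ proj₂ u)
  farPair⇒1≤ t u far = ≤⇒≤ᵇ (≤-trans (≤-trans 1≤k+2 (m≤n+m (k + 2) (proj₂ t))) (farPair⇒≤ t u far))

  farPair-shift : ∀ ε δ m n s → farPair k (ε , m + s) (δ , n + s) ≡ farPair k (ε , m) (δ , n)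
  farPair-shift ε δ m n s = begin
    farPair k (ε , m + s) (δ , n + s)  ≡⟨ farPair-gap ε δ (m + s) (n + s) ⟩
    (m + s + gap ε δ ≤ᵇ n + s)         ≡⟨ cong (_≤ᵇ n + s) (+-comm-middle m s (gap ε δ)) ⟩
    (m + gap ε δ + s ≤ᵇ n + s)         ≡⟨ ≤ᵇ-+ʳ s (m + gap ε δ) n ⟩
    (m + gap ε δ ≤ᵇ n)                 ≡⟨ farPair-gap ε δ m n ⟨
    farPair k (ε , m) (δ , n)          ∎
    where
    +-comm-middle : ∀ a b c → a + b + c ≡ a + c + b
    +-comm-middle = solve-∀

  farDiff-∷ʳ : ∀ l t →
    farDiff k (l ∷ʳ t) ≡ (farDiff k l ∧ allᵇ (λ a → farPair k a t) l) ∧ (1 ≤ᵇ proj₂ t)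
  farDiff-∷ʳ []      t = ∧-identityʳ (1 ≤ᵇ proj₂ t)
  farDiff-∷ʳ (a ∷ l) t = begin
    A ∧ allᵇ (farPair k a) (l ∷ʳ t) ∧ farDiff k (l ∷ʳ t)
      ≡⟨ cong₂ (λ x y → A ∧ x ∧ y) (allᵇ-∷ʳ (farPair k a) l t) (farDiff-∷ʳ l t) ⟩
    A ∧ (P ∧ X) ∧ ((F ∧ Q) ∧ O)
      ≡⟨ rearrange A P X F Q O ⟩
    ((A ∧ P ∧ F) ∧ (X ∧ Q)) ∧ O ∎
    where
    A = 1 ≤ᵇ proj₂ a
    P = allᵇ (farPair k a) l
    X = farPair k a t
    F = farDiff k l
    Q = allᵇ (λ b → farPair k b t) l
    O = 1 ≤ᵇ proj₂ t
    rearrange : ∀ a p x f q o → a ∧ (p ∧ x) ∧ ((f ∧ q) ∧ o) ≡ ((a ∧ p ∧ f) ∧ (x ∧ q)) ∧ o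
    rearrange = solve 6
      (λ a p x f q o → a ⊕ (p ⊕ x) ⊕ ((f ⊕ q) ⊕ o) ⊜ ((a ⊕ (p ⊕ f)) ⊕ (x ⊕ q)) ⊕ o) refl

  -- The gaps from the earlier terms to t follow from the gap u–t by transitivity.
  farDiff-∷ʳ-∷ʳ : ∀ l u t → farDiff k (l ∷ʳ u ∷ʳ t) ≡ farDiff k (l ∷ʳ u) ∧ farPair k u t
  farDiff-∷ʳ-∷ʳ l u t = begin
    farDiff k (l ∷ʳ u ∷ʳ t)
      ≡⟨ farDiff-∷ʳ (l ∷ʳ u) t ⟩
    (farDiff k (l ∷ʳ u) ∧ allᵇ (λ a → farPair k a t) (l ∷ʳ u)) ∧ (1 ≤ᵇ proj₂ t)
      ≡⟨ cong (λ x → (farDiff k (l ∷ʳ u) ∧ x) ∧ (1 ≤ᵇ proj₂ t))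
              (allᵇ-∷ʳ (λ a → farPair k a t) l u) ⟩
    (farDiff k (l ∷ʳ u) ∧ (allᵇ (λ a → farPair k a t) l ∧ farPair k u t)) ∧ (1 ≤ᵇ proj₂ t)
      ≡⟨ ∧-drop-implied _ _ _ _ implied ⟩
    farDiff k (l ∷ʳ u) ∧ farPair k u t ∎
    where
    implied : T (farDiff k (l ∷ʳ u)) → T (farPair k u t) →
              T (allᵇ (λ a → farPair k a t) l ∧ (1 ≤ᵇ proj₂ t))
    implied lu-far ut-far = Equivalence.from T-∧
      ( allᵇ-mono (λ a au-far → farPair-trans a u t au-far ut-far) l all-far-u
      , farPair⇒1≤ u t ut-far )
      where
      all-far-u : T (allᵇ (λ a → farPair k a u) l)
      all-far-u = proj₂ (Equivalence.to (T-∧ {farDiff k l} {allᵇ (λ a → farPair k a u) l})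
        (proj₁ (Equivalence.to (T-∧ {farDiff k l ∧ allᵇ (λ a → farPair k a u) l} {1 ≤ᵇ proj₂ u})
          (subst T (farDiff-∷ʳ l u) lu-far))))

  -- The far-difference lists l ∷ʳ t with all indices of l at most n, each counted with the
  -- weight w of its first term.
  reaching : (Term → ℕ) → Term → ℕ → ℕ
  reaching w t zero    = w t
  reaching w t (suc n) = reaching w t n
    + (when (farPair k (pos , suc n) t) (reaching w (pos , suc n) n)
    +  when (farPair k (neg , suc n) t) (reaching w (neg , suc n) n))

  ending : (Term → ℕ) → Sgn → ℕ → ℕ
  ending w δ zero    = 0
  ending w δ (suc n) = reaching w (δ , suc n) n

  count-reaching : ∀ g t n →
    count (λ l → farDiff k (l ∷ʳ t) ∧ firstSatisfies g (l ∷ʳ t)) (candidates n) ≡ reaching (weight g) t n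
  count-reaching g (ε , zero)  zero    = refl
  count-reaching g (ε , suc _) zero    = refl
  count-reaching g t           (suc n) = begin
    count p (candidates (suc n))
      ≡⟨ count-candidates-suc p n ⟩
    count p (candidates n) + (count (p ∘ (_∷ʳ (pos , suc n))) (candidates n)
                             + count (p ∘ (_∷ʳ (neg , suc n))) (candidates n))
      ≡⟨ cong₂ _+_ (count-reaching g t n) (cong₂ _+_ (appending pos) (appending neg)) ⟩
    reaching (weight g) t (suc n) ∎
    where
    p : List Term → Bool
    p l = farDiff k (l ∷ʳ t) ∧ firstSatisfies g (l ∷ʳ t)
    split : ∀ u l → p (l ∷ʳ u) ≡ (farDiff k (l ∷ʳ u) ∧ firstSatisfies g (l ∷ʳ u)) ∧ farPair k u t
    split u l = trans (cong₂ _∧_ (farDiff-∷ʳ-∷ʳ l u t) (firstSatisfies-∷ʳ-∷ʳ g l u t))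
      (xy∙z≈xz∙y (farDiff k (l ∷ʳ u)) (farPair k u t) (firstSatisfies g (l ∷ʳ u)))
    appending : ∀ δ → count (p ∘ (_∷ʳ (δ , suc n))) (candidates n)
                    ≡ when (farPair k (δ , suc n) t) (reaching (weight g) (δ , suc n) n)
    appending δ = trans (count-cong (split (δ , suc n)) (candidates n))
      (trans (count-∧ʳ _ _ (candidates n)) (cong (when _) (count-reaching g (δ , suc n) n)))

  count-lastIs-beyond : ∀ (p : List Term → Bool) δ {m} n → n < m →
    count (λ l → p l ∧ lastIs (δ , m) l) (candidates n) ≡ 0
  count-lastIs-beyond p δ zero    _   = cong (λ b → when b 1) (∧-zeroʳ (p []))
  count-lastIs-beyond p δ {m} (suc n) n<m = begin
    count q (candidates (suc n))
      ≡⟨ count-candidates-suc q n ⟩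
    count q (candidates n) + (count (q ∘ (_∷ʳ (pos , suc n))) (candidates n)
                             + count (q ∘ (_∷ʳ (neg , suc n))) (candidates n))
      ≡⟨ cong₂ _+_ (count-lastIs-beyond p δ n (<-trans (n<1+n n) n<m))
                   (cong₂ _+_ (count-none (not-last pos) (candidates n)) (count-none (not-last neg) (candidates n))) ⟩
    0 ∎
    where
    q : List Term → Bool
    q l = p l ∧ lastIs (δ , m) l
    not-last : ∀ δ′ l → q (l ∷ʳ (δ′ , suc n)) ≡ false
    not-last δ′ l = trans (cong (p (l ∷ʳ (δ′ , suc n)) ∧_)
        (trans (lastIs-∷ʳ (δ , m) l (δ′ , suc n)) (termEq-≢ δ δ′ λ m≡1+n → <-irrefl (sym m≡1+n) n<m)))
      (∧-zeroʳ _)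

  count-ending : ∀ g δ j →
    count (λ l → farDiff k l ∧ firstSatisfies g l ∧ lastIs (δ , j) l) (candidates j) ≡ ending (weight g) δ j
  count-ending g δ zero    = refl
  count-ending g δ (suc n) = begin
    count q (candidates (suc n))
      ≡⟨ count-candidates-suc q n ⟩
    count q (candidates n) + (count (q ∘ (_∷ʳ (pos , suc n))) (candidates n)
                             + count (q ∘ (_∷ʳ (neg , suc n))) (candidates n))
      ≡⟨ cong₂ _+_ none-earlier (cong₂ _+_ (appending pos) (appending neg)) ⟩
    0 + (when (δ ==ˢ pos) (reaching (weight g) (pos , suc n) n)
       + when (δ ==ˢ neg) (reaching (weight g) (neg , suc n) n))
      ≡⟨ select δ ⟩
    ending (weight g) δ (suc n) ∎
    where
    q : List Term → Bool
    q l = farDiff k l ∧ firstSatisfies g l ∧ lastIs (δ , suc n) l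
    none-earlier : count q (candidates n) ≡ 0
    none-earlier = trans (count-cong (λ l → sym (∧-assoc (farDiff k l) _ _)) (candidates n))
      (count-lastIs-beyond (λ l → farDiff k l ∧ firstSatisfies g l) δ n ≤-refl)
    split : ∀ δ′ l → let L = l ∷ʳ (δ′ , suc n) in q L ≡ (farDiff k L ∧ firstSatisfies g L) ∧ (δ ==ˢ δ′)
    split δ′ l = trans (cong (λ b → farDiff k L ∧ firstSatisfies g L ∧ b)
        (trans (lastIs-∷ʳ (δ , suc n) l (δ′ , suc n)) (termEq-same-index δ δ′ (suc n))))
      (sym (∧-assoc (farDiff k L) (firstSatisfies g L) (δ ==ˢ δ′)))
      where
      L = l ∷ʳ (δ′ , suc n)
    appending : ∀ δ′ → count (q ∘ (_∷ʳ (δ′ , suc n))) (candidates n)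
                     ≡ when (δ ==ˢ δ′) (reaching (weight g) (δ′ , suc n) n)
    appending δ′ = trans (count-cong (split δ′) (candidates n))
      (trans (count-∧ʳ _ _ (candidates n)) (cong (when _) (count-reaching g (δ′ , suc n) n)))
    select : ∀ δ → 0 + (when (δ ==ˢ pos) (reaching (weight g) (pos , suc n) n)
                     + when (δ ==ˢ neg) (reaching (weight g) (neg , suc n) n))
                   ≡ ending (weight g) δ (suc n)
    select pos = +-identityʳ _
    select neg = refl

  reaching-cong : ∀ {w₁ w₂} → w₁ ≗ w₂ → ∀ t n → reaching w₁ t n ≡ reaching w₂ t n
  reaching-cong w₁≗w₂ t zero    = w₁≗w₂ t
  reaching-cong w₁≗w₂ t (suc n) = cong₂ _+_ (reaching-cong w₁≗w₂ t n)
    (cong₂ _+_ (cong (when (farPair k (pos , suc n) t)) (reaching-cong w₁≗w₂ (pos , suc n) n))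
               (cong (when (farPair k (neg , suc n) t)) (reaching-cong w₁≗w₂ (neg , suc n) n)))

  ending-cong : ∀ {w₁ w₂} → w₁ ≗ w₂ → ∀ δ n → ending w₁ δ n ≡ ending w₂ δ n
  ending-cong w₁≗w₂ δ zero    = refl
  ending-cong w₁≗w₂ δ (suc n) = reaching-cong w₁≗w₂ (δ , suc n) n

  reaching-+ʷ : ∀ w₁ w₂ t n → reaching (w₁ +ʷ w₂) t n ≡ reaching w₁ t n + reaching w₂ t n
  reaching-+ʷ w₁ w₂ t zero    = refl
  reaching-+ʷ w₁ w₂ t (suc n) = begin
    reaching (w₁ +ʷ w₂) t n + (extend (w₁ +ʷ w₂) pos + extend (w₁ +ʷ w₂) neg)
      ≡⟨ cong₂ _+_ (reaching-+ʷ w₁ w₂ t n) (cong₂ _+_ (extend-+ʷ pos) (extend-+ʷ neg)) ⟩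
    (reaching w₁ t n + reaching w₂ t n) + ((extend w₁ pos + extend w₂ pos) + (extend w₁ neg + extend w₂ neg))
      ≡⟨ cong (_+_ (reaching w₁ t n + reaching w₂ t n))
              (interchange (extend w₁ pos) (extend w₂ pos) (extend w₁ neg) (extend w₂ neg)) ⟩
    (reaching w₁ t n + reaching w₂ t n) + ((extend w₁ pos + extend w₁ neg) + (extend w₂ pos + extend w₂ neg))
      ≡⟨ interchange (reaching w₁ t n) (reaching w₂ t n)
                     (extend w₁ pos + extend w₁ neg) (extend w₂ pos + extend w₂ neg) ⟩
    reaching w₁ t (suc n) + reaching w₂ t (suc n) ∎
    where
    extend : (Term → ℕ) → Sgn → ℕ
    extend w ε = when (farPair k (ε , suc n) t) (reaching w (ε , suc n) n)
    extend-+ʷ : ∀ ε → extend (w₁ +ʷ w₂) ε ≡ extend w₁ ε + extend w₂ ε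
    extend-+ʷ ε = trans (cong (when (farPair k (ε , suc n) t)) (reaching-+ʷ w₁ w₂ (ε , suc n) n))
      (when-+ (farPair k (ε , suc n) t) (reaching w₁ (ε , suc n) n) (reaching w₂ (ε , suc n) n))

  ending-+ʷ : ∀ w₁ w₂ δ n → ending (w₁ +ʷ w₂) δ n ≡ ending w₁ δ n + ending w₂ δ n
  ending-+ʷ w₁ w₂ δ zero    = refl
  ending-+ʷ w₁ w₂ δ (suc n) = reaching-+ʷ w₁ w₂ (δ , suc n) n

  module _ {w : Term → ℕ} {s : ℕ} (w-vanishes : ∀ δ m → m ≤ s → w (δ , m) ≡ 0) where

    reaching-below : ∀ n → n ≤ s → ∀ t → reaching w t n ≡ w t
    reaching-below zero    _   t = refl
    reaching-below (suc n) n<s t = trans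
      (cong₂ _+_ (reaching-below n (<⇒≤ n<s) t) (cong₂ _+_ (vanish pos) (vanish neg)))
      (+-identityʳ (w t))
      where
      vanish : ∀ ε → when (farPair k (ε , suc n) t) (reaching w (ε , suc n) n) ≡ 0
      vanish ε = trans
        (cong (when (farPair k (ε , suc n) t))
              (trans (reaching-below n (<⇒≤ n<s) (ε , suc n)) (w-vanishes ε (suc n) n<s)))
        (when-0 (farPair k (ε , suc n) t))

    ending-below : ∀ δ n → n ≤ s → ending w δ n ≡ 0
    ending-below δ zero    _   = refl
    ending-below δ (suc n) n<s = trans (reaching-below n (<⇒≤ n<s) (δ , suc n)) (w-vanishes δ (suc n) n<s)

    reaching-shift : ∀ δ m n → reaching w (δ , m + s) (n + s) ≡ reaching (shift s w) (δ , m) n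
    reaching-shift δ m zero    = reaching-below s ≤-refl (δ , m + s)
    reaching-shift δ m (suc n) = cong₂ _+_ (reaching-shift δ m n)
      (cong₂ _+_ (cong₂ when (farPair-shift pos δ (suc n) m s) (reaching-shift pos (suc n) n))
                 (cong₂ when (farPair-shift neg δ (suc n) m s) (reaching-shift neg (suc n) n)))

    ending-shift : ∀ δ n → ending w δ (n + s) ≡ ending (shift s w) δ n
    ending-shift δ zero    = ending-below δ s ≤-refl
    ending-shift δ (suc n) = reaching-shift δ (suc n) n

  module _ {w : Term → ℕ} (w-symmetric : SignSymmetric w) where

    reaching-sign : ∀ m n → reaching w (pos , m) n ≡ reaching w (neg , m) n
    reaching-sign m zero    = w-symmetric m
    -- farPair only depends on whether the two signs agree.
    reaching-sign m (suc n) = cong₂ _+_ (reaching-sign m n) (begin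
      when same X₊ + when mixed X₋  ≡⟨ +-comm (when same X₊) (when mixed X₋) ⟩
      when mixed X₋ + when same X₊  ≡⟨ cong₂ (λ x y → when mixed x + when same y) (sym X₊≡X₋) X₊≡X₋ ⟩
      when mixed X₊ + when same X₋  ∎)
      where
      X₊ = reaching w (pos , suc n) n
      X₋ = reaching w (neg , suc n) n
      X₊≡X₋ = reaching-sign (suc n) n
      same = farPair k (pos , suc n) (pos , m)
      mixed = farPair k (neg , suc n) (pos , m)

    ending-sign : ∀ n → ending w pos n ≡ ending w neg n
    ending-sign zero    = refl
    ending-sign (suc n) = reaching-sign (suc n) n

    -- Before a positive term the gap is 2k+2 after a positive term and k+2 after a negative
    -- one; by symmetry both kinds of earlier terms are counted by ending w pos.
    reaching-pos : ∀ m n → reaching w (pos , m) n ≡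
      w (pos , m) + (partialSum (ending w pos) (n ⊓ (m ∸ (2 * k + 2)))
                   + partialSum (ending w pos) (n ⊓ (m ∸ (k + 2))))
    reaching-pos m zero    = sym (+-identityʳ _)
    reaching-pos m (suc n) = begin
      reaching w (pos , m) n + (when c₁ (ending w pos (suc n)) + when c₂ (ending w neg (suc n)))
        ≡⟨ cong₂ _+_ (reaching-pos m n)
                     (cong (_+_ (when c₁ a)) (cong (when c₂) (sym (ending-sign (suc n))))) ⟩
      (w (pos , m) + (A₁ n + A₂ n)) + (when c₁ a + when c₂ a)
        ≡⟨ +-assoc (w (pos , m)) (A₁ n + A₂ n) (when c₁ a + when c₂ a) ⟩
      w (pos , m) + ((A₁ n + A₂ n) + (when c₁ a + when c₂ a))
        ≡⟨ cong (_+_ (w (pos , m))) (interchange (A₁ n) (A₂ n) (when c₁ a) (when c₂ a)) ⟩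
      w (pos , m) + ((A₁ n + when c₁ a) + (A₂ n + when c₂ a))
        ≡⟨ cong (_+_ (w (pos , m))) (cong₂ _+_ (partialSum-⊓ (ending w pos) (2 * k + 2) m n)
                                                 (partialSum-⊓ (ending w pos) (k + 2) m n)) ⟨
      w (pos , m) + (A₁ (suc n) + A₂ (suc n)) ∎
      where
      a = ending w pos (suc n)
      c₁ = suc n + (2 * k + 2) ≤ᵇ m
      c₂ = suc n + (k + 2) ≤ᵇ m
      A₁ A₂ : ℕ → ℕ
      A₁ i = partialSum (ending w pos) (i ⊓ (m ∸ (2 * k + 2)))
      A₂ i = partialSum (ending w pos) (i ⊓ (m ∸ (k + 2)))

    ending-pos-suc : ∀ n → ending w pos (suc n) ≡
      w (pos , suc n) + (partialSum (ending w pos) (suc n ∸ (2 * k + 2))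
                       + partialSum (ending w pos) (suc n ∸ (k + 2)))
    ending-pos-suc n = trans (reaching-pos (suc n) n)
      (cong (_+_ (w (pos , suc n))) (cong₂ _+_ (cutoff (2 * k + 2) 1≤2k+2) (cutoff (k + 2) 1≤k+2)))
      where
      cutoff : ∀ g → 1 ≤ g →
               partialSum (ending w pos) (n ⊓ (suc n ∸ g)) ≡ partialSum (ending w pos) (suc n ∸ g)
      cutoff g 1≤g = cong (partialSum (ending w pos)) (m≥n⇒m⊓n≡n (suc-∸-≤ n g 1≤g))

  N₂≡ending : ∀ ε i δ j → N₂ k ε i δ j ≡ ending (weight (termEq (ε , i))) δ j
  N₂≡ending ε i δ j = trans (count-cong first (candidates j)) (count-ending (termEq (ε , i)) δ j)
    where
    first : ∀ l → (farDiff k l ∧ firstIs (ε , i) l ∧ lastIs (δ , j) l)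
                ≡ (farDiff k l ∧ firstSatisfies (termEq (ε , i)) l ∧ lastIs (δ , j) l)
    first []      = refl
    first (_ ∷ _) = refl

  N₁≡ending : ∀ δ j → N₁ k δ j ≡ ending (weight (λ _ → true)) δ j
  N₁≡ending δ j = trans (count-cong first (candidates j)) (count-ending (λ _ → true) δ j)
    where
    first : ∀ l → (farDiff k l ∧ lastIs (δ , j) l)
                ≡ (farDiff k l ∧ firstSatisfies (λ _ → true) l ∧ lastIs (δ , j) l)
    first []      = refl
    first (_ ∷ _) = refl

  S-aux-fuel : ∀ {f f′} n → n ≤ f → n ≤ f′ → S-aux k f n ≡ S-aux k f′ n
  S-aux-fuel {zero}  {zero}   zero    _         _          = refl
  S-aux-fuel {zero}  {suc _}  zero    _         _          = refl
  S-aux-fuel {suc _} {zero}   zero    _         _          = refl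
  S-aux-fuel {suc _} {suc _}  zero    _         _          = refl
  S-aux-fuel {suc f} {suc f′} (suc n) (s≤s n≤f) (s≤s n≤f′) = if-cong-else (suc n ≤ᵇ suc k)
    (cong₂ _+_ (S-aux-fuel n n≤f n≤f′)
               (S-aux-fuel (n ∸ k) (≤-trans (m∸n≤m n k) n≤f) (≤-trans (m∸n≤m n k) n≤f′)))

  S-suc : ∀ n → S k (suc n) ≡ (if suc n ≤ᵇ suc k then suc n else S k n + S k (n ∸ k))
  S-suc n = if-cong-else (suc n ≤ᵇ suc k) (cong (_+_ (S k n)) (S-aux-fuel (n ∸ k) (m∸n≤m n k) ≤-refl))

  S-initial : ∀ n → n ≤ suc k → S k n ≡ n
  S-initial zero    _   = refl
  S-initial (suc n) n≤k = trans (S-suc n) (if-T (≤⇒≤ᵇ n≤k))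

  S-step : ∀ n → k < n → S k (suc n) ≡ S k n + S k (n ∸ k)
  S-step n k<n = trans (S-suc n) (if-¬T λ n<k+1 → <⇒≱ k<n (≤-pred (≤ᵇ⇒≤ (suc n) (suc k) n<k+1)))

  R-aux-fuel : ∀ {f f′} n → n ≤ f → n ≤ f′ → R-aux k f n ≡ R-aux k f′ n
  R-aux-fuel {zero}  {zero}   zero    _         _          = refl
  R-aux-fuel {zero}  {suc _}  zero    _         _          = refl
  R-aux-fuel {suc _} {zero}   zero    _         _          = refl
  R-aux-fuel {suc _} {suc _}  zero    _         _          = refl
  R-aux-fuel {suc f} {suc f′} (suc n) (s≤s n≤f) (s≤s n≤f′) = cong (_+_ (S k (suc n)))
    (R-aux-fuel (suc n ∸ (2 * k + 2)) (≤-trans below n≤f) (≤-trans below n≤f′))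
    where
    below = suc-∸-≤ n (2 * k + 2) 1≤2k+2

  R-step : ∀ n → R k n ≡ S k n + R k (n ∸ (2 * k + 2))
  R-step zero    = sym (cong (R k) (0∸n≡0 (2 * k + 2)))
  R-step (suc n) = cong (_+_ (S k (suc n)))
    (R-aux-fuel (suc n ∸ (2 * k + 2)) (suc-∸-≤ n (2 * k + 2) 1≤2k+2) ≤-refl)

  R-initial : ∀ n → n ≤ k → R k n ≡ n
  R-initial n n≤k = begin
    R k n
      ≡⟨ R-step n ⟩
    S k n + R k (n ∸ (2 * k + 2))
      ≡⟨ cong₂ _+_ (S-initial n (m≤n⇒m≤1+n n≤k)) (cong (R k) (m≤n⇒m∸n≡0 n≤2k+2)) ⟩
    n + 0
      ≡⟨ +-identityʳ n ⟩
    n ∎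
    where
    n≤2k+2 : n ≤ 2 * k + 2
    n≤2k+2 = ≤-trans n≤k (≤-trans (m≤m+n k 2) k+2≤2k+2)

  S-via-R : ∀ m → S k (suc m) ≡ suc (R k m + R k (suc m ∸ (k + 2)))
  S-via-R = <-rec _ step
    where
    step : ∀ m → (∀ {p} → p < m → S k (suc p) ≡ suc (R k p + R k (suc p ∸ (k + 2)))) →
           S k (suc m) ≡ suc (R k m + R k (suc m ∸ (k + 2)))
    step m ih with m ≤? k
    ... | yes m≤k = begin
      S k (suc m)
        ≡⟨ S-initial (suc m) (s≤s m≤k) ⟩
      suc m
        ≡⟨ cong suc (+-identityʳ m) ⟨
      suc (m + 0)
        ≡⟨ cong₂ (λ a b → suc (a + b)) (R-initial m m≤k) (cong (R k) m+1∸[k+2]≡0) ⟨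
      suc (R k m + R k (suc m ∸ (k + 2))) ∎
      where
      m+1∸[k+2]≡0 : suc m ∸ (k + 2) ≡ 0
      m+1∸[k+2]≡0 = m≤n⇒m∸n≡0 (≤-trans (s≤s m≤k) (subst (suc k ≤_) (+-comm 2 k) (n≤1+n (suc k))))
    ... | no m≰k = begin
      S k (suc m)
        ≡⟨ S-step m k<m ⟩
      S k m + S k (m ∸ k)
        ≡⟨ cong (λ i → S k m + S k i) m∸k≡1+p ⟩
      S k m + S k (suc p)
        ≡⟨ cong (_+_ (S k m)) (ih p<m) ⟩
      S k m + suc (R k p + R k (suc p ∸ (k + 2)))
        ≡⟨ cong (λ i → S k m + suc (R k p + R k i)) 1+p∸[k+2] ⟩
      S k m + suc (R k p + R k (m ∸ (2 * k + 2)))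
        ≡⟨ regroup (S k m) (R k p) (R k (m ∸ (2 * k + 2))) ⟩
      suc ((S k m + R k (m ∸ (2 * k + 2))) + R k p)
        ≡⟨ cong (λ i → suc (i + R k p)) (R-step m) ⟨
      suc (R k m + R k p)
        ≡⟨ cong (λ i → suc (R k m + R k i)) (cong (suc m ∸_) (+-comm k 2)) ⟨
      suc (R k m + R k (suc m ∸ (k + 2))) ∎
      where
      k<m = ≰⇒> m≰k
      p = m ∸ suc k
      m∸k≡1+p : m ∸ k ≡ suc p
      m∸k≡1+p = ∸≡suc[∸suc] k<m
      p<m : p < m
      p<m = subst (_≤ m) m∸k≡1+p (m∸n≤m m k)
      1+p∸[k+2] : suc p ∸ (k + 2) ≡ m ∸ (2 * k + 2)
      1+p∸[k+2] = begin
        suc p ∸ (k + 2)    ≡⟨ cong (_∸ (k + 2)) m∸k≡1+p ⟨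
        m ∸ k ∸ (k + 2)    ≡⟨ ∸-+-assoc m k (k + 2) ⟩
        m ∸ (k + (k + 2))  ≡⟨ cong (m ∸_) (k+[k+2] k) ⟩
        m ∸ (2 * k + 2)    ∎
        where
        k+[k+2] : ∀ k → k + (k + 2) ≡ 2 * k + 2
        k+[k+2] = solve-∀
      regroup : ∀ a b c → a + suc (b + c) ≡ suc ((a + c) + b)
      regroup = solve-∀

  R-recurrence : ∀ n → R k (suc n) ≡ R k n + suc (R k (suc n ∸ (2 * k + 2)) + R k (suc n ∸ (k + 2)))
  R-recurrence n = begin
    R k (suc n)
      ≡⟨ R-step (suc n) ⟩
    S k (suc n) + R k (suc n ∸ (2 * k + 2))
      ≡⟨ cong (_+ R k (suc n ∸ (2 * k + 2))) (S-via-R n) ⟩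
    suc (R k n + R k (suc n ∸ (k + 2))) + R k (suc n ∸ (2 * k + 2))
      ≡⟨ regroup (R k n) _ _ ⟩
    R k n + suc (R k (suc n ∸ (2 * k + 2)) + R k (suc n ∸ (k + 2))) ∎
    where
    regroup : ∀ a b c → suc (a + b) + c ≡ a + suc (c + b)
    regroup = solve-∀

  partialSum-N₁≡R : ∀ n → partialSum (ending (weight (λ _ → true)) pos) n ≡ R k n
  partialSum-N₁≡R = recurrence-unique 1≤2k+2 1≤k+2 refl
    (λ n → cong (_+_ (partialSum (ending (weight (λ _ → true)) pos) n))
                (ending-pos-suc weight-true-symmetric n))
    R-recurrence

  N₁-pos+R≡R-suc : ∀ n → N₁ k pos (suc n) + R k n ≡ R k (suc n)
  N₁-pos+R≡R-suc n = begin
    N₁ k pos (suc n) + R k n         ≡⟨ cong₂ _+_ (N₁≡ending pos (suc n)) (sym (partialSum-N₁≡R n)) ⟩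
    a (suc n) + partialSum a n       ≡⟨ +-comm (a (suc n)) _ ⟩
    partialSum a (suc n)             ≡⟨ partialSum-N₁≡R (suc n) ⟩
    R k (suc n)                      ∎
    where
    a = ending (weight (λ _ → true)) pos

  N₁-split : ∀ n → (N₂ k neg 1 pos (suc n) + N₂ k pos 1 pos (suc n)) + N₁ k pos n ≡ N₁ k pos (suc n)
  N₁-split n = sym (begin
    N₁ k pos (suc n)
      ≡⟨ trans (N₁≡ending pos (suc n)) (ending-cong weight-split pos (suc n)) ⟩
    ending ((w₋ +ʷ w₊) +ʷ w₂) pos (suc n)
      ≡⟨ trans (ending-+ʷ (w₋ +ʷ w₊) w₂ pos (suc n))
               (cong (_+ ending w₂ pos (suc n)) (ending-+ʷ w₋ w₊ pos (suc n))) ⟩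
    (ending w₋ pos (suc n) + ending w₊ pos (suc n)) + ending w₂ pos (suc n)
      ≡⟨ cong₂ _+_ (sym (cong₂ _+_ (N₂≡ending neg 1 pos (suc n)) (N₂≡ending pos 1 pos (suc n))))
                   later-first ⟩
    (N₂ k neg 1 pos (suc n) + N₂ k pos 1 pos (suc n)) + N₁ k pos n ∎)
    where
    w₋ = weight (termEq (neg , 1))
    w₊ = weight (termEq (pos , 1))
    w₂ = weight atLeastTwo
    later-first : ending w₂ pos (suc n) ≡ N₁ k pos n
    later-first = begin
      ending w₂ pos (suc n)                    ≡⟨ cong (ending w₂ pos) (+-comm 1 n) ⟩
      ending w₂ pos (n + 1)                    ≡⟨ ending-shift weight-atLeastTwo-vanishes pos n ⟩
      ending (shift 1 w₂) pos n                ≡⟨ ending-cong shift-weight-atLeastTwo pos n ⟩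
      ending (weight (λ _ → true)) pos n       ≡⟨ N₁≡ending pos n ⟨
      N₁ k pos n                               ∎

  N₂-shift : ∀ ε s δ n → N₂ k ε (suc s) δ (n + s) ≡ N₂ k ε 1 δ n
  N₂-shift ε s δ n = begin
    N₂ k ε (suc s) δ (n + s)                            ≡⟨ N₂≡ending ε (suc s) δ (n + s) ⟩
    ending (weight (termEq (ε , suc s))) δ (n + s)      ≡⟨ ending-shift (weight-termEq-vanishes ε s) δ n ⟩
    ending (shift s (weight (termEq (ε , suc s)))) δ n  ≡⟨ ending-cong (shift-weight-termEq ε s) δ n ⟩
    ending (weight (termEq (ε , 1))) δ n                ≡⟨ N₂≡ending ε 1 δ n ⟨
    N₂ k ε 1 δ n                                        ∎

lemma4p3 : (k : ℕ) →
    ((i j : ℕ) → 1 ≤ i → i ≤ j → (ε δ : Sgn) →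
      N₂ k ε i δ j ≡ N₂ k ε 1 δ (j ∸ i + 1))
    × ((j : ℕ) → 1 ≤ j →
      (+ N₂ k neg 1 pos j) Data.Integer.+ (+ N₂ k pos 1 pos j) ≡ (+ N₁ k pos j) - (+ N₁ k pos (j ∸ 1)))
    × ((i : ℕ) → 1 ≤ i →
      + N₁ k pos i ≡ (+ R k i) - (+ R k (i ∸ 1)))
lemma4p3 k = translation , first-term-split , N₁-difference
  where
  translation : (i j : ℕ) → 1 ≤ i → i ≤ j → (ε δ : Sgn) → N₂ k ε i δ j ≡ N₂ k ε 1 δ (j ∸ i + 1)
  translation (suc s) j _ i≤j ε δ =
    trans (cong (N₂ k ε (suc s) δ) (sym (trans (+-assoc (j ∸ suc s) 1 s) (m∸n+n≡m i≤j))))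
          (N₂-shift k ε s δ (j ∸ suc s + 1))

  first-term-split : (j : ℕ) → 1 ≤ j →
    (+ N₂ k neg 1 pos j) Data.Integer.+ (+ N₂ k pos 1 pos j) ≡ (+ N₁ k pos j) - (+ N₁ k pos (j ∸ 1))
  first-term-split (suc n) _ = trans (sym (ℤₚ.pos-+ (N₂ k neg 1 pos (suc n)) (N₂ k pos 1 pos (suc n))))
                                     (m+n≡o⇒+m≡+o-+n (N₁-split k n))

  N₁-difference : (i : ℕ) → 1 ≤ i → + N₁ k pos i ≡ (+ R k i) - (+ R k (i ∸ 1))
  N₁-difference (suc n) _ = m+n≡o⇒+m≡+o-+n (N₁-pos+R≡R-suc k n)
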